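{- The class of Zykov graphs is closed under subdividing edges: if $G$ is a Zykov graph and $H$ is obtained from $G$ by subdividing edges (any number of times), then $H$ is a Zykov graph.
   Context: Zykov's construction: $Z_1$ is the graph with one vertex. Given $Z_1,\dots,Z_k$ ($k\ge 1$), the graph $Z_{k+1}$ is obtained by taking the disjoint union of $Z_1,\dots,Z_k$ and, for each $k$-tuple $(v_1,\dots,v_k)$ with $v_i\in V(Z_i)$, adding a new vertex adjacent exactly to $v_1,\dots,v_k$. A Zykov graph is any graph isomorphic to an induced subgraph of $Z_k$ for some integer $k\ge 1$. -}

module Defs where

open import Data.Nat using (ℕ; zero; suc; _≤_)
open import Data.Fin using (Fin; zero; suc)
open import Data.Unit using (⊤; tt)
open import Data.Empty using (⊥)
open import Data.Sum using (_⊎_; inj₁; inj₂)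
open import Data.Product using (Σ; _×_; _,_)
open import Relation.Nullary using (¬_)
open import Relation.Binary.PropositionalEquality using (_≡_)
open import Function.Bundles using (_⇔_)
open import Function.Definitions using (Injective)

record Graph : Set₁ where
  field
    V : Set
    E : V → V → Set
open Graph public

emptyGraph : Graph
emptyGraph = record { V = ⊥ ; E = λ _ _ → ⊥ }

Tuple : (k : ℕ) → (Fin k → Graph) → Set
Tuple zero    gs = ⊤
Tuple (suc k) gs = V (gs zero) × Tuple k (λ i → gs (suc i))

proj : ∀ {k} {gs : Fin k → Graph} → Tuple k gs → (i : Fin k) → V (gs i)
proj {suc k} (x , t) zero    = x
proj {suc k} (x , t) (suc i) = proj t i

-- One Zykov step: disjoint union of gs 0, …, gs (k-1) together with a new
-- vertex for each k-tuple, adjacent exactly to the entries of the tuple.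
StepV : (k : ℕ) → (Fin k → Graph) → Set
StepV k gs = (Σ (Fin k) λ i → V (gs i)) ⊎ Tuple k gs

data StepE (k : ℕ) (gs : Fin k → Graph) : StepV k gs → StepV k gs → Set where
  old  : ∀ i (u w : V (gs i)) → E (gs i) u w → StepE k gs (inj₁ (i , u)) (inj₁ (i , w))
  up   : ∀ (t : Tuple k gs) i → StepE k gs (inj₁ (i , proj t i)) (inj₂ t)
  down : ∀ (t : Tuple k gs) i → StepE k gs (inj₂ t) (inj₁ (i , proj t i))

step : (k : ℕ) → (Fin k → Graph) → Graph
step k gs = record { V = StepV k gs ; E = StepE k gs }

snoc : ∀ {A : Set₁} {k} → (Fin k → A) → A → Fin (suc k) → A
snoc {k = zero}  f a zero    = a
snoc {k = suc k} f a zero    = f zero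
snoc {k = suc k} f a (suc i) = snoc (λ j → f (suc j)) a i

-- Zs k = (Z₁, …, Zₖ)
Zs : (k : ℕ) → Fin k → Graph
Zs zero    ()
Zs (suc k) = snoc (Zs k) (step k (Zs k))

-- Z k = Zₖ for k ≥ 1 (Z₁ = step 0 (empty family) is a single vertex);
-- Z 0 is an unused dummy.
Z : ℕ → Graph
Z zero    = emptyGraph
Z (suc k) = step k (Zs k)

InducedEmbedding : Graph → Graph → Set
InducedEmbedding G H =
  Σ (V G → V H) λ f → Injective _≡_ _≡_ f × (∀ u v → E G u v ⇔ E H (f u) (f v))

Zykov : Graph → Set
Zykov G = Σ ℕ λ k → 1 ≤ k × InducedEmbedding G (Z k)

data SubE (G : Graph) (u v : V G) : V G ⊎ ⊤ → V G ⊎ ⊤ → Set where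
  keep : ∀ x y → E G x y → ¬ (x ≡ u × y ≡ v) → ¬ (x ≡ v × y ≡ u) →
         SubE G u v (inj₁ x) (inj₁ y)
  uw : SubE G u v (inj₁ u) (inj₂ tt)
  wu : SubE G u v (inj₂ tt) (inj₁ u)
  vw : SubE G u v (inj₁ v) (inj₂ tt)
  wv : SubE G u v (inj₂ tt) (inj₁ v)

subdivide : (G : Graph) → (u v : V G) → Graph
subdivide G u v = record { V = V G ⊎ ⊤ ; E = SubE G u v }

data SubdivisionOf (G : Graph) : Graph → Set₁ where
  base : SubdivisionOf G G
  sub  : ∀ {H} → SubdivisionOf G H → (u v : V H) → E H u v →
         SubdivisionOf G (subdivide H u v)

-- Subdividing an edge commutes with passing to induced subgraphs, so it suffices to
-- subdivide the edges of Z_{k+1} = step k (Z_1, …, Z_k), by induction along the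
-- construction. First move the copy Z_i containing an endpoint of the edge to a new first
-- slot. An edge inside Z_i is then subdivided inside that slot, which is Zykov by induction.
-- An edge from x ∈ Z_i to a top vertex t becomes the path x – p – t with p a pendant vertex
-- at x: the first slot holds step 1 (Z_i), i.e. Z_i with a pendant at each vertex, and t is
-- re-attached to p instead of x. Either way the subdivided graph is an induced subgraph of a
-- Zykov step applied to Zykov graphs, and such a step is again Zykov: for N large, embed the
-- i-th of the k graphs into the copy of Z_{N+i} inside Z_{N+k+1}, and fill the first N
-- entries of the tuples arbitrarily.

module Submission where

open import Defs
open import Data.Nat using (ℕ; zero; suc; _+_; _⊔_; _<_; s≤s; z≤n)
open import Data.Nat.Properties using (m≤m⊔n; m≤n⊔m; m≤m+n; <-≤-trans)
open import Data.Fin using (Fin; zero; suc; toℕ; fromℕ<; _↑ʳ_) renaming (_≟_ to _≟ᶠ_)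
open import Data.Fin.Properties using (toℕ-↑ʳ; toℕ-fromℕ<)
open import Data.Vec.Functional using (_∷_; tail)
open import Data.Unit using (⊤; tt)
open import Data.Sum using (_⊎_; inj₁; inj₂) renaming (map to ⊎-map)
open import Data.Sum.Properties
  using (inj₁-injective; inj₂-injective) renaming (≡-dec to ⊎-≡-dec)
open import Data.Product using (Σ; _×_; _,_; proj₁; proj₂)
open import Data.Product.Properties
  using (,-injectiveˡ; ,-injectiveʳ) renaming (≡-dec to Σ-≡-dec)
open import Function using (_∘_; id)
open import Function.Bundles using (_⇔_; mk⇔; Equivalence)
open import Function.Properties.Equivalence using () renaming (refl to ⇔-refl; trans to ⇔-trans)
open import Function.Definitions using (Injective)
open import Function.Consequences.Propositional
  using (inverseʳ⇒injective; strictlyInverseʳ⇒inverseʳ)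
open import Relation.Nullary using (Dec; yes; no; contradiction)
open import Relation.Binary.Definitions using (DecidableEquality)
open import Relation.Binary.PropositionalEquality using (_≡_; refl; sym; trans; cong; cong₂)

record _↪_ (G H : Graph) : Set where
  field
    map       : V G → V H
    injective : Injective _≡_ _≡_ map
    adjacent  : ∀ u v → E G u v ⇔ E H (map u) (map v)
open _↪_

mk↪ : ∀ {G H} (f : V G → V H) → Injective _≡_ _≡_ f →
      (∀ {u v} → E G u v → E H (f u) (f v)) → (∀ u v → E H (f u) (f v) → E G u v) →
      G ↪ H
mk↪ f f-inj to from =
  record { map = f ; injective = f-inj ; adjacent = λ u v → mk⇔ to (from u v) }

↪-refl : ∀ {G} → G ↪ G
↪-refl = record { map = id ; injective = id ; adjacent = λ _ _ → ⇔-refl }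

↪-reflexive : ∀ {G H} → G ≡ H → G ↪ H
↪-reflexive refl = ↪-refl

↪-trans : ∀ {A B C} → A ↪ B → B ↪ C → A ↪ C
↪-trans f g = record
  { map       = map g ∘ map f
  ; injective = injective f ∘ injective g
  ; adjacent  = λ u v → ⇔-trans (adjacent f u v) (adjacent g _ _)
  }

retraction⇒injective : ∀ {A B : Set} {f : A → B} (g : B → A) → (∀ x → g (f x) ≡ x) →
                       Injective _≡_ _≡_ f
retraction⇒injective {f = f} g gf =
  inverseʳ⇒injective f (strictlyInverseʳ⇒inverseʳ {f⁻¹ = g} f gf)

pattern copy i x = inj₁ (i , x)
pattern top t    = inj₂ t
pattern mid      = inj₂ tt

module _ {k : ℕ} {gs : Fin k → Graph} where

  copy-injective : ∀ {i} {x y : V (gs i)} → _≡_ {A = StepV k gs} (copy i x) (copy i y) → x ≡ y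
  copy-injective refl = refl

  up′ : ∀ {t i x} → proj t i ≡ x → StepE k gs (copy i x) (top t)
  up′ {t} {i} refl = up t i

  down′ : ∀ {t i x} → proj t i ≡ x → StepE k gs (top t) (copy i x)
  down′ {t} {i} refl = down t i

  up⁻¹ : ∀ {t i x} → StepE k gs (copy i x) (top t) → proj t i ≡ x
  up⁻¹ (up t i) = refl

  down⁻¹ : ∀ {t i x} → StepE k gs (top t) (copy i x) → proj t i ≡ x
  down⁻¹ (down t i) = refl

tabulate : ∀ {k} {gs : Fin k → Graph} → (∀ i → V (gs i)) → Tuple k gs
tabulate {zero}  h = tt
tabulate {suc k} {gs} h = h zero , tabulate {k} {gs ∘ suc} (h ∘ suc)

Tuple-map : ∀ {k} {Cs Es : Fin k → Graph} → (∀ i → V (Cs i) → V (Es i)) →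
            Tuple k Cs → Tuple k Es
Tuple-map {zero}          f tt      = tt
Tuple-map {suc k} {Cs} {Es} f (x , t) = f zero x , Tuple-map {k} {Cs ∘ suc} {Es ∘ suc} (f ∘ suc) t

proj-Tuple-map : ∀ {k} {Cs Es : Fin k → Graph} (f : ∀ i → V (Cs i) → V (Es i)) t i →
                 proj {gs = Es} (Tuple-map {Cs = Cs} f t) i ≡ f i (proj t i)
proj-Tuple-map {suc k}           f (x , t) zero    = refl
proj-Tuple-map {suc k} {Cs} {Es} f (x , t) (suc i) =
  proj-Tuple-map {k} {Cs ∘ suc} {Es ∘ suc} (f ∘ suc) t i

Tuple-map-injective : ∀ {k} {Cs Es : Fin k → Graph} {f : ∀ i → V (Cs i) → V (Es i)} →
                      (∀ i → Injective _≡_ _≡_ (f i)) →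
                      Injective _≡_ _≡_ (Tuple-map {k} {Cs} {Es} f)
Tuple-map-injective {zero}  f-inj {tt}    {tt}    _  = refl
Tuple-map-injective {suc k} {Cs} {Es} f-inj {x , s} {y , t} eq =
  cong₂ _,_ (f-inj zero (,-injectiveˡ eq))
            (Tuple-map-injective {k} {Cs ∘ suc} {Es ∘ suc} (f-inj ∘ suc) (,-injectiveʳ eq))

Tuple-≡-dec : ∀ {k} {gs : Fin k → Graph} → (∀ i → DecidableEquality (V (gs i))) →
              DecidableEquality (Tuple k gs)
Tuple-≡-dec {zero}  _    tt tt = yes refl
Tuple-≡-dec {suc k} {gs} _≟_ = Σ-≡-dec (_≟_ zero) (Tuple-≡-dec {k} {gs ∘ suc} (_≟_ ∘ suc))

step-≡-dec : ∀ {k} {gs : Fin k → Graph} → (∀ i → DecidableEquality (V (gs i))) →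
             DecidableEquality (V (step k gs))
step-≡-dec _≟_ = ⊎-≡-dec (Σ-≡-dec _≟ᶠ_ (_≟_ _)) (Tuple-≡-dec _≟_)

copy-↪ : ∀ {k} {gs : Fin k → Graph} i → gs i ↪ step k gs
copy-↪ {k} {gs} i = mk↪ (copy i) copy-injective (old i _ _) from
  where
    from : ∀ x y → StepE k gs (copy i x) (copy i y) → E (gs i) x y
    from x y (old _ _ _ e) = e

step-map-↪ : ∀ {k} {Cs Es : Fin k → Graph} → (∀ i → Cs i ↪ Es i) →
             step k Cs ↪ step k Es
step-map-↪ {k} {Cs} {Es} f = mk↪ F F-injective to from
  where
    F : V (step k Cs) → V (step k Es)
    F (copy i x) = copy i (map (f i) x)
    F (top t)    = top (Tuple-map (map ∘ f) t)

    proj-F : ∀ t i → proj (Tuple-map {Cs = Cs} (map ∘ f) t) i ≡ map (f i) (proj t i)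
    proj-F = proj-Tuple-map (map ∘ f)

    F-injective : Injective _≡_ _≡_ F
    F-injective {copy i x} {copy j y} eq with ,-injectiveˡ (inj₁-injective eq)
    ... | refl = cong (copy i) (injective (f i) (copy-injective eq))
    F-injective {top s}    {top t}    eq =
      cong top (Tuple-map-injective (injective ∘ f) (inj₂-injective eq))

    to : ∀ {u v} → StepE k Cs u v → StepE k Es (F u) (F v)
    to (old i x y e) = old i _ _ (Equivalence.to (adjacent (f i) x y) e)
    to (up t i)      = up′ (proj-F t i)
    to (down t i)    = down′ (proj-F t i)

    from : ∀ u v → StepE k Es (F u) (F v) → StepE k Cs u v
    from (copy i x) (copy .i y) (old _ _ _ e) = old i x y (Equivalence.from (adjacent (f i) x y) e)
    from (copy i x) (top t)  e = up′ (injective (f i) (trans (sym (proj-F t i)) (up⁻¹ e)))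
    from (top t)  (copy i x) e = down′ (injective (f i) (trans (sym (proj-F t i)) (down⁻¹ e)))

step-tail-↪ : ∀ {k} {Es : Fin (suc k) → Graph} → V (Es zero) →
              step k (tail Es) ↪ step (suc k) Es
step-tail-↪ {k} {Es} d = mk↪ F F-injective to from
  where
    F : V (step k (tail Es)) → V (step (suc k) Es)
    F (copy i x) = copy (suc i) x
    F (top t)    = top (d , t)

    F-injective : Injective _≡_ _≡_ F
    F-injective {copy i x} {copy .i .x} refl = refl
    F-injective {top s}    {top .s}     refl = refl

    to : ∀ {u v} → StepE k (tail Es) u v → StepE (suc k) Es (F u) (F v)
    to (old i x y e) = old (suc i) x y e
    to (up t i)      = up (d , t) (suc i)
    to (down t i)    = down (d , t) (suc i)

    from : ∀ u v → StepE (suc k) Es (F u) (F v) → StepE k (tail Es) u v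
    from (copy i x) (copy .i y) (old _ _ _ e) = old i x y e
    from (copy i _) (top t)  (up _ _)   = up t i
    from (top t)  (copy i _) (down _ _) = down t i

step-↑ʳ-↪ : ∀ N {k} {Es : Fin (N + k) → Graph} → (∀ l → V (Es l)) →
            step k (Es ∘ (N ↑ʳ_)) ↪ step (N + k) Es
step-↑ʳ-↪ zero    d = ↪-refl
step-↑ʳ-↪ (suc N) d = ↪-trans (step-↑ʳ-↪ N (d ∘ suc)) (step-tail-↪ (d zero))

module _ {k : ℕ} {gs : Fin k → Graph} (i : Fin k) where

  focus : V (step k gs) → V (step (suc k) (gs i ∷ gs))
  focus (copy j x) with j ≟ᶠ i
  ... | yes refl = copy zero x
  ... | no _     = copy (suc j) x
  focus (top t) = top (proj t i , t)

  focus-here : ∀ x → focus (copy i x) ≡ copy zero x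
  focus-here x with i ≟ᶠ i
  ... | yes refl = refl
  ... | no i≢i   = contradiction refl i≢i

  focus-↪ : step k gs ↪ step (suc k) (gs i ∷ gs)
  focus-↪ = mk↪ focus (retraction⇒injective unfocus unfocus-focus) to from
    where
      unfocus : V (step (suc k) (gs i ∷ gs)) → V (step k gs)
      unfocus (copy zero x)    = copy i x
      unfocus (copy (suc j) x) = copy j x
      unfocus (top (_ , t))    = top t

      unfocus-focus : ∀ u → unfocus (focus u) ≡ u
      unfocus-focus (copy j x) with j ≟ᶠ i
      ... | yes refl = refl
      ... | no _     = refl
      unfocus-focus (top t) = refl

      to : ∀ {u v} → StepE k gs u v → StepE (suc k) (gs i ∷ gs) (focus u) (focus v)
      to (old j x y e) with j ≟ᶠ i
      ... | yes refl = old zero x y e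
      ... | no _     = old (suc j) x y e
      to (up t j) with j ≟ᶠ i
      ... | yes refl = up (proj t i , t) zero
      ... | no _     = up (proj t i , t) (suc j)
      to (down t j) with j ≟ᶠ i
      ... | yes refl = down (proj t i , t) zero
      ... | no _     = down (proj t i , t) (suc j)

      from : ∀ u v → StepE (suc k) (gs i ∷ gs) (focus u) (focus v) → StepE k gs u v
      from (copy j x) (copy l y) e with j ≟ᶠ i | l ≟ᶠ i | e
      ... | yes refl | yes refl | old _ _ _ e′ = old i x y e′
      ... | no _     | no _     | old _ _ _ e′ = old j x y e′
      ... | yes refl | no _     | ()
      ... | no _     | yes refl | ()
      from (copy j x) (top t) e with j ≟ᶠ i | e
      ... | yes refl | up _ _ = up t i
      ... | no _     | up _ _ = up t j
      from (top t) (copy j x) e with j ≟ᶠ i | e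
      ... | yes refl | down _ _ = down t i
      ... | no _     | down _ _ = down t j

module _ {G : Graph} {u v : V G} where

  to-mid : ∀ {x} → x ≡ u ⊎ x ≡ v → SubE G u v (inj₁ x) mid
  to-mid (inj₁ refl) = uw
  to-mid (inj₂ refl) = vw

  from-mid : ∀ {x} → x ≡ u ⊎ x ≡ v → SubE G u v mid (inj₁ x)
  from-mid (inj₁ refl) = wu
  from-mid (inj₂ refl) = wv

  to-mid⁻¹ : ∀ {x} → SubE G u v (inj₁ x) mid → x ≡ u ⊎ x ≡ v
  to-mid⁻¹ uw = inj₁ refl
  to-mid⁻¹ vw = inj₂ refl

  from-mid⁻¹ : ∀ {x} → SubE G u v mid (inj₁ x) → x ≡ u ⊎ x ≡ v
  from-mid⁻¹ wu = inj₁ refl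
  from-mid⁻¹ wv = inj₂ refl

subdivide-↪ : ∀ {G H} (f : G ↪ H) {u v u′ v′} → map f u ≡ u′ → map f v ≡ v′ →
              subdivide G u v ↪ subdivide H u′ v′
subdivide-↪ {G} {H} f {u} {v} refl refl = mk↪ F F-injective to from
  where
    F : V G ⊎ ⊤ → V H ⊎ ⊤
    F (inj₁ x) = inj₁ (map f x)
    F mid      = mid

    F-injective : Injective _≡_ _≡_ F
    F-injective {inj₁ x} {inj₁ y} eq   = cong inj₁ (injective f (inj₁-injective eq))
    F-injective {mid}    {mid}    refl = refl

    f-injective² : ∀ {x y x′ y′} → map f x ≡ map f x′ × map f y ≡ map f y′ →
                   x ≡ x′ × y ≡ y′
    f-injective² (p , q) = injective f p , injective f q

    f-cong² : ∀ {x y x′ y′} → x ≡ x′ × y ≡ y′ →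
              map f x ≡ map f x′ × map f y ≡ map f y′
    f-cong² (p , q) = cong (map f) p , cong (map f) q

    to : ∀ {a b} → SubE G u v a b → SubE H (map f u) (map f v) (F a) (F b)
    to (keep x y e n₁ n₂) =
      keep _ _ (Equivalence.to (adjacent f x y) e) (n₁ ∘ f-injective²) (n₂ ∘ f-injective²)
    to uw = uw
    to wu = wu
    to vw = vw
    to wv = wv

    from : ∀ a b → SubE H (map f u) (map f v) (F a) (F b) → SubE G u v a b
    from (inj₁ x) (inj₁ y) (keep _ _ e n₁ n₂) =
      keep x y (Equivalence.from (adjacent f x y) e) (n₁ ∘ f-cong²) (n₂ ∘ f-cong²)
    from (inj₁ x) mid e = to-mid (⊎-map (injective f) (injective f) (to-mid⁻¹ e))
    from mid (inj₁ x) e = from-mid (⊎-map (injective f) (injective f) (from-mid⁻¹ e))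

subdivide-swap : ∀ {G u v} → subdivide G u v ↪ subdivide G v u
subdivide-swap {G} = mk↪ id id swap (λ _ _ → swap)
  where
    swap : ∀ {u v a b} → SubE G u v a b → SubE G v u a b
    swap (keep x y e n₁ n₂) = keep x y e n₂ n₁
    swap uw = vw
    swap wu = wv
    swap vw = uw
    swap wv = wu

module _ {k : ℕ} {hs : Fin (suc k) → Graph} where

  subdivide-copy-↪ : ∀ u w → subdivide (step (suc k) hs) (copy zero u) (copy zero w) ↪
                             step (suc k) (subdivide (hs zero) u w ∷ tail hs)
  subdivide-copy-↪ u w = mk↪ F (retraction⇒injective F⁻¹ F⁻¹-F) to from
    where
      H : Graph
      H = step (suc k) (subdivide (hs zero) u w ∷ tail hs)

      F : V (step (suc k) hs) ⊎ ⊤ → V H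
      F (inj₁ (copy zero x))    = copy zero (inj₁ x)
      F (inj₁ (copy (suc j) x)) = copy (suc j) x
      F (inj₁ (top (x , s)))    = top (inj₁ x , s)
      F mid                     = copy zero mid

      F⁻¹ : V H → V (step (suc k) hs) ⊎ ⊤
      F⁻¹ (copy zero (inj₁ x)) = inj₁ (copy zero x)
      F⁻¹ (copy zero mid)      = mid
      F⁻¹ (copy (suc j) x)     = inj₁ (copy (suc j) x)
      F⁻¹ (top (inj₁ x , s))   = inj₁ (top (x , s))
      F⁻¹ (top (mid , s))      = mid

      F⁻¹-F : ∀ a → F⁻¹ (F a) ≡ a
      F⁻¹-F (inj₁ (copy zero x))    = refl
      F⁻¹-F (inj₁ (copy (suc j) x)) = refl
      F⁻¹-F (inj₁ (top t))          = refl
      F⁻¹-F mid                     = refl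

      to : ∀ {a b} → SubE (step (suc k) hs) (copy zero u) (copy zero w) a b → E H (F a) (F b)
      to (keep _ _ (old zero x y e) n₁ n₂) =
        old zero _ _ (keep x y e (λ { (refl , refl) → n₁ (refl , refl) })
                                 (λ { (refl , refl) → n₂ (refl , refl) }))
      to (keep _ _ (old (suc j) x y e) _ _) = old (suc j) x y e
      to (keep _ _ (up (x , s) zero) _ _)      = up (inj₁ x , s) zero
      to (keep _ _ (up (x , s) (suc j)) _ _)   = up (inj₁ x , s) (suc j)
      to (keep _ _ (down (x , s) zero) _ _)    = down (inj₁ x , s) zero
      to (keep _ _ (down (x , s) (suc j)) _ _) = down (inj₁ x , s) (suc j)
      to uw = old zero _ _ uw
      to wu = old zero _ _ wu
      to vw = old zero _ _ vw
      to wv = old zero _ _ wv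

      from : ∀ a b → E H (F a) (F b) →
             SubE (step (suc k) hs) (copy zero u) (copy zero w) a b
      from (inj₁ (copy zero x)) (inj₁ (copy zero y)) (old _ _ _ (keep _ _ e n₁ n₂)) =
        keep _ _ (old zero x y e) (λ { (refl , refl) → n₁ (refl , refl) })
                                  (λ { (refl , refl) → n₂ (refl , refl) })
      from (inj₁ (copy (suc j) x)) (inj₁ (copy (suc .j) y)) (old _ _ _ e) =
        keep _ _ (old (suc j) x y e) (λ { (() , _) }) (λ { (() , _) })
      from (inj₁ (copy zero x)) (inj₁ (top t)) (up _ _) =
        keep _ _ (up t zero) (λ { (_ , ()) }) (λ { (_ , ()) })
      from (inj₁ (copy (suc j) x)) (inj₁ (top t)) (up _ _) =
        keep _ _ (up t (suc j)) (λ { (_ , ()) }) (λ { (_ , ()) })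
      from (inj₁ (top t)) (inj₁ (copy zero x)) (down _ _) =
        keep _ _ (down t zero) (λ { (() , _) }) (λ { (() , _) })
      from (inj₁ (top t)) (inj₁ (copy (suc j) x)) (down _ _) =
        keep _ _ (down t (suc j)) (λ { (() , _) }) (λ { (() , _) })
      from (inj₁ (copy zero x)) mid (old _ _ _ uw) = uw
      from (inj₁ (copy zero x)) mid (old _ _ _ vw) = vw
      from mid (inj₁ (copy zero x)) (old _ _ _ wu) = wu
      from mid (inj₁ (copy zero x)) (old _ _ _ wv) = wv
      from mid mid (old _ _ _ ())

withPendants : Graph → Graph
withPendants G = step 1 (λ _ → G)

module _ {k : ℕ} {hs : Fin (suc k) → Graph} (_≟_ : DecidableEquality (Tuple (suc k) hs)) where

  subdivide-top-↪ : ∀ x₀ s₀ → subdivide (step (suc k) hs) (copy zero x₀) (top (x₀ , s₀)) ↪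
                               step (suc k) (withPendants (hs zero) ∷ tail hs)
  subdivide-top-↪ x₀ s₀ = mk↪ F (retraction⇒injective F⁻¹ F⁻¹-F) to from
    where
      H : Graph
      H = step (suc k) (withPendants (hs zero) ∷ tail hs)

      t₀ : Tuple (suc k) hs
      t₀ = x₀ , s₀

      anchor : ∀ t → Dec (t ≡ t₀) → V (withPendants (hs zero))
      anchor (x , _) (yes _) = top (x , tt)
      anchor (x , _) (no _)  = copy zero x

      F : V (step (suc k) hs) ⊎ ⊤ → V H
      F (inj₁ (copy zero x))    = copy zero (copy zero x)
      F (inj₁ (copy (suc j) x)) = copy (suc j) x
      F (inj₁ (top t))          = top (anchor t (t ≟ t₀) , proj₂ t)
      F mid                     = copy zero (top (x₀ , tt))

      F⁻¹ : V H → V (step (suc k) hs) ⊎ ⊤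
      F⁻¹ (copy zero (copy _ x))     = inj₁ (copy zero x)
      F⁻¹ (copy zero (top _))        = mid
      F⁻¹ (copy (suc j) x)           = inj₁ (copy (suc j) x)
      F⁻¹ (top (copy _ x , s))       = inj₁ (top (x , s))
      F⁻¹ (top (top (x , _) , s))    = inj₁ (top (x , s))

      F⁻¹-F : ∀ a → F⁻¹ (F a) ≡ a
      F⁻¹-F (inj₁ (copy zero x))    = refl
      F⁻¹-F (inj₁ (copy (suc j) x)) = refl
      F⁻¹-F (inj₁ (top t)) with t ≟ t₀
      ... | yes _ = refl
      ... | no _  = refl
      F⁻¹-F mid                     = refl

      to : ∀ {a b} → SubE (step (suc k) hs) (copy zero x₀) (top t₀) a b → E H (F a) (F b)
      to (keep _ _ (old zero x y e) _ _)    = old zero _ _ (old zero x y e)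
      to (keep _ _ (old (suc j) x y e) _ _) = old (suc j) x y e
      to (keep _ _ (up t zero) n₁ _) with t ≟ t₀
      ... | yes refl = contradiction (refl , refl) n₁
      ... | no _     = up _ zero
      to (keep _ _ (up t (suc j)) _ _) = up _ (suc j)
      to (keep _ _ (down t zero) _ n₂) with t ≟ t₀
      ... | yes refl = contradiction (refl , refl) n₂
      ... | no _     = down _ zero
      to (keep _ _ (down t (suc j)) _ _) = down _ (suc j)
      to uw = old zero _ _ (up (x₀ , tt) zero)
      to wu = old zero _ _ (down (x₀ , tt) zero)
      to vw with t₀ ≟ t₀
      ... | yes _     = down _ zero
      ... | no t₀≢t₀  = contradiction refl t₀≢t₀
      to wv with t₀ ≟ t₀
      ... | yes _     = up _ zero
      ... | no t₀≢t₀  = contradiction refl t₀≢t₀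

      from : ∀ a b → E H (F a) (F b) →
             SubE (step (suc k) hs) (copy zero x₀) (top t₀) a b
      from (inj₁ (copy zero x)) (inj₁ (copy zero y)) (old _ _ _ (old _ _ _ e)) =
        keep _ _ (old zero x y e) (λ { (_ , ()) }) (λ { (() , _) })
      from (inj₁ (copy (suc j) x)) (inj₁ (copy (suc .j) y)) (old _ _ _ e) =
        keep _ _ (old (suc j) x y e) (λ { (() , _) }) (λ { (() , _) })
      from (inj₁ (copy zero x)) (inj₁ (top t)) e with t ≟ t₀ | e
      ... | no t≢t₀ | up _ _ =
        keep _ _ (up t zero) (λ { (_ , refl) → t≢t₀ refl }) (λ { (() , _) })
      from (inj₁ (copy (suc j) x)) (inj₁ (top t)) (up _ _) =
        keep _ _ (up t (suc j)) (λ { (() , _) }) (λ { (() , _) })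
      from (inj₁ (top t)) (inj₁ (copy zero x)) e with t ≟ t₀ | e
      ... | no t≢t₀ | down _ _ =
        keep _ _ (down t zero) (λ { (() , _) }) (λ { (refl , _) → t≢t₀ refl })
      from (inj₁ (top t)) (inj₁ (copy (suc j) x)) (down _ _) =
        keep _ _ (down t (suc j)) (λ { (() , _) }) (λ { (_ , ()) })
      from (inj₁ (copy zero x)) mid (old _ _ _ (up _ _)) = uw
      from mid (inj₁ (copy zero x)) (old _ _ _ (down _ _)) = wu
      from (inj₁ (top t)) mid e with t ≟ t₀ | e
      ... | yes refl | down _ _ = vw
      from mid (inj₁ (top t)) e with t ≟ t₀ | e
      ... | yes refl | up _ _ = wv
      from mid mid (old _ _ _ ())

snoc-all : ∀ {A : Set₁} (P : A → Set) {k} {f : Fin k → A} {a} →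
           (∀ i → P (f i)) → P a → ∀ i → P (snoc f a i)
snoc-all P {zero}  _  Pa zero    = Pa
snoc-all P {suc k} Pf _  zero    = Pf zero
snoc-all P {suc k} Pf Pa (suc i) = snoc-all P (Pf ∘ suc) Pa i

snoc-toℕ : ∀ {A : Set₁} (g : ℕ → A) {k} {f : Fin k → A} {a} →
           (∀ i → f i ≡ g (toℕ i)) → a ≡ g k → ∀ i → snoc f a i ≡ g (toℕ i)
snoc-toℕ g {zero}  _  a≡ zero    = a≡
snoc-toℕ g {suc k} f≡ _  zero    = f≡ zero
snoc-toℕ g {suc k} f≡ a≡ (suc i) = snoc-toℕ (g ∘ suc) (f≡ ∘ suc) a≡ i

Zs-ind : (P : Graph → Set) → (∀ k → (∀ i → P (Zs k i)) → P (Z (suc k))) →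
         ∀ k i → P (Zs k i)
Zs-ind P step-P zero    ()
Zs-ind P step-P (suc k) = snoc-all P (Zs-ind P step-P k) (step-P k (Zs-ind P step-P k))

Zs≡Z : ∀ k i → Zs k i ≡ Z (suc (toℕ i))
Zs≡Z zero    ()
Zs≡Z (suc k) = snoc-toℕ (Z ∘ suc) (Zs≡Z k) refl

Z-↪-< : ∀ {n m} → n < m → Z (suc n) ↪ Z (suc m)
Z-↪-< {n} {m} n<m = ↪-trans (↪-reflexive Z≡Zs) (copy-↪ (fromℕ< n<m))
  where
    Z≡Zs : Z (suc n) ≡ Zs m (fromℕ< n<m)
    Z≡Zs = sym (trans (Zs≡Z m (fromℕ< n<m)) (cong (Z ∘ suc) (toℕ-fromℕ< n<m)))

Zs-inhabited : ∀ k i → V (Zs k i)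
Zs-inhabited = Zs-ind V (λ _ x → top (tabulate x))

↪⇒Zykov : ∀ {G n} → G ↪ Z (suc n) → Zykov G
↪⇒Zykov {n = n} f = suc n , s≤s z≤n , map f , injective f , adjacent f

Zykov⇒↪ : ∀ {G} → Zykov G → Σ ℕ λ n → G ↪ Z (suc n)
Zykov⇒↪ (suc n , _ , f , f-injective , f-adjacent) =
  n , record { map = f ; injective = f-injective ; adjacent = f-adjacent }

↪-Zykov : ∀ {G H} → G ↪ H → Zykov H → Zykov G
↪-Zykov f zyk with Zykov⇒↪ zyk
... | _ , g = ↪⇒Zykov (↪-trans f g)

strict-upper-bound : ∀ {k} (f : Fin k → ℕ) → Σ ℕ λ N → ∀ i → f i < N
strict-upper-bound {zero}  f = 0 , λ ()
strict-upper-bound {suc k} f with strict-upper-bound (f ∘ suc)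
... | N , f<N = suc (f zero) ⊔ N , λ { zero    → m≤m⊔n (suc (f zero)) N
                                    ; (suc i) → <-≤-trans (f<N i) (m≤n⊔m _ N) }

step-Zykov : ∀ {k} {Cs : Fin k → Graph} → (∀ i → Zykov (Cs i)) → Zykov (step k Cs)
step-Zykov {k} {Cs} Cs-Zykov =
  ↪⇒Zykov (↪-trans (step-map-↪ Cs↪Zs) (step-↑ʳ-↪ N (Zs-inhabited (N + k))))
  where
    level : Fin k → ℕ
    level i = proj₁ (Zykov⇒↪ (Cs-Zykov i))

    N : ℕ
    N = proj₁ (strict-upper-bound level)

    level<N+i : ∀ i → level i < N + toℕ i
    level<N+i i = <-≤-trans (proj₂ (strict-upper-bound level) i) (m≤m+n N (toℕ i))

    Zs≡Z-↑ʳ : ∀ i → Zs (N + k) (N ↑ʳ i) ≡ Z (suc (N + toℕ i))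
    Zs≡Z-↑ʳ i = trans (Zs≡Z (N + k) (N ↑ʳ i)) (cong (Z ∘ suc) (toℕ-↑ʳ N i))

    Cs↪Zs : ∀ i → Cs i ↪ Zs (N + k) (N ↑ʳ i)
    Cs↪Zs i = ↪-trans (proj₂ (Zykov⇒↪ (Cs-Zykov i)))
                (↪-trans (Z-↪-< (level<N+i i)) (↪-reflexive (sym (Zs≡Z-↑ʳ i))))

ZykovSubdivisions : Graph → Set
ZykovSubdivisions G = ∀ u v → E G u v → Zykov (subdivide G u v)

module _ {k : ℕ} {gs : Fin k → Graph} (gs-Zykov : ∀ i → Zykov (gs i)) where

  subdivide-copy-Zykov : ∀ i {u w} → Zykov (subdivide (gs i) u w) →
                         Zykov (subdivide (step k gs) (copy i u) (copy i w))
  subdivide-copy-Zykov i {u} {w} zyk =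
    ↪-Zykov (↪-trans (subdivide-↪ (focus-↪ i) (focus-here i u) (focus-here i w))
                     (subdivide-copy-↪ {hs = gs i ∷ gs} u w))
            (step-Zykov λ { zero → zyk ; (suc j) → gs-Zykov j })

  subdivide-top-Zykov : (∀ i → DecidableEquality (V (gs i))) →
                        ∀ t i → Zykov (subdivide (step k gs) (copy i (proj t i)) (top t))
  subdivide-top-Zykov _≟_ t i =
    ↪-Zykov (↪-trans (subdivide-↪ (focus-↪ i) (focus-here i (proj t i)) refl)
                     (subdivide-top-↪ {hs = gs i ∷ gs} _≟ᵗ_ (proj t i) t))
            (step-Zykov λ { zero → step-Zykov (λ _ → gs-Zykov i) ; (suc j) → gs-Zykov j })
    where
      _≟ᵗ_ : DecidableEquality (Tuple (suc k) (gs i ∷ gs))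
      _≟ᵗ_ = Tuple-≡-dec {gs = gs i ∷ gs} λ { zero → _≟_ i ; (suc j) → _≟_ j }

  step-subdivisions : (∀ i → DecidableEquality (V (gs i))) →
                      (∀ i → ZykovSubdivisions (gs i)) → ZykovSubdivisions (step k gs)
  step-subdivisions _ ih _ _ (old i u w e) = subdivide-copy-Zykov i (ih i u w e)
  step-subdivisions _≟_ _ _ _ (up t i)     = subdivide-top-Zykov _≟_ t i
  step-subdivisions _≟_ _ _ _ (down t i)   = ↪-Zykov subdivide-swap (subdivide-top-Zykov _≟_ t i)

Zs-Zykov : ∀ k i → Zykov (Zs k i)
Zs-Zykov = Zs-ind Zykov (λ _ → step-Zykov)

Zs-≡-dec : ∀ k i → DecidableEquality (V (Zs k i))
Zs-≡-dec = Zs-ind (DecidableEquality ∘ V) (λ _ → step-≡-dec)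

Zs-subdivisions : ∀ k i → ZykovSubdivisions (Zs k i)
Zs-subdivisions = Zs-ind ZykovSubdivisions (λ k → step-subdivisions (Zs-Zykov k) (Zs-≡-dec k))

Z-subdivisions : ∀ n → ZykovSubdivisions (Z (suc n))
Z-subdivisions n = step-subdivisions (Zs-Zykov n) (Zs-≡-dec n) (Zs-subdivisions n)

Zykov-subdivide : ∀ {G} → Zykov G → ZykovSubdivisions G
Zykov-subdivide zyk u v e with Zykov⇒↪ zyk
... | n , f =
  ↪-Zykov (subdivide-↪ f refl refl) (Z-subdivisions n _ _ (Equivalence.to (adjacent f u v) e))

lemma2 : (G H : Graph) → Zykov G → SubdivisionOf G H → Zykov H
lemma2 G .G zyk base          = zyk
lemma2 G _  zyk (sub s u v e) = Zykov-subdivide (lemma2 G _ zyk s) u v e
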